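{- Let $d=1$. The minimum number of slots of a growth schedule for a path graph on $n$ vertices is $\lceil n/2\rceil$, and the minimum number of slots of a growth schedule for a star graph on $n$ vertices is $n-1$.
   Context: Growth schedules with edge-activation distance $d$ (a fixed positive integer). A growth schedule of $k$ slots produces graphs $G_0,\dots,G_k$, where $G_0=(\{u_0\},\emptyset)$ is a single vertex. In slot $t$ the process sets $G_t=G_{t-1}$; for every $u\in V(G_{t-1})$ it may add at most one new vertex $u'$ with the edge $uu'$ and any subset of the edges $\{vu' : v\in V(G_{t-1}),\ \mathrm{dist}_{G_{t-1}}(u,v)\le d-1\}$ (for $d=1$ only the edge $uu'$); finally it deletes any set of edges of $G_t$ whose deletion does not disconnect $G_t$. The schedule grows $G$ if $G_k\cong G$. -}

module Defs where

open import Data.Nat using (ℕ; zero; suc; _+_; _∸_; _≤_)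
open import Data.Fin using (Fin; toℕ; splitAt)
open import Data.Sum using (_⊎_; inj₁; inj₂)
open import Data.Product using (_×_; _,_; Σ; ∃)
open import Data.Empty using (⊥)
open import Relation.Nullary using (¬_)
open import Relation.Binary.PropositionalEquality using (_≡_; _≢_)
open import Relation.Binary.Construct.Closure.ReflexiveTransitive using (Star)
open import Function.Bundles using (_↔_; Inverse; _⇔_)
open import Function.Definitions using (Injective)

record Graph : Set₁ where
  field
    size   : ℕ
    Adj    : Fin size → Fin size → Set
    sym    : ∀ {u v} → Adj u v → Adj v u
    irrefl : ∀ {u} → ¬ Adj u u
open Graph public

Connected : Graph → Set
Connected G = ∀ u v → Star (Adj G) u v

data WithinDist (G : Graph) : ℕ → Fin (size G) → Fin (size G) → Set where
  here  : ∀ {k u} → WithinDist G k u u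
  step  : ∀ {k u w v} → Adj G u w → WithinDist G k w v → WithinDist G (suc k) u v

record _≅_ (G H : Graph) : Set where
  field
    bij      : Fin (size G) ↔ Fin (size H)
    preserve : ∀ u v → Adj G u v ⇔ Adj H (Inverse.to bij u) (Inverse.to bij v)

-- Old vertices of G_{t-1} are  Fin m  (m = size G); the a new vertices
-- are indexed by Fin a; vertex set of G_t is Fin (m + a), split via splitAt.
-- New vertex w has parent (u with u' = w); parent is injective (each u adds
-- at most one vertex).  Extra w v: the optionally activated edge v w',
-- allowed only when dist_{G_{t-1}}(parent w, v) ≤ d - 1.

module _ (G : Graph) {a : ℕ} (parent : Fin a → Fin (size G))
         (Extra : Fin a → Fin (size G) → Set) where

  NewEdge : Fin a → Fin (size G) → Set
  NewEdge w v = v ≡ parent w ⊎ Extra w v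

  PreAdj⊎ : Fin (size G) ⊎ Fin a → Fin (size G) ⊎ Fin a → Set
  PreAdj⊎ (inj₁ i) (inj₁ j) = Adj G i j
  PreAdj⊎ (inj₁ i) (inj₂ w) = NewEdge w i
  PreAdj⊎ (inj₂ w) (inj₁ j) = NewEdge w j
  PreAdj⊎ (inj₂ _) (inj₂ _) = ⊥

  -- G_t before the deletion phase
  PreAdj : Fin (size G + a) → Fin (size G + a) → Set
  PreAdj x y = PreAdj⊎ (splitAt (size G) x) (splitAt (size G) y)

  PreAdj⊎-sym : ∀ {x y} → PreAdj⊎ x y → PreAdj⊎ y x
  PreAdj⊎-sym {inj₁ i} {inj₁ j} e = sym G e
  PreAdj⊎-sym {inj₁ i} {inj₂ w} e = e
  PreAdj⊎-sym {inj₂ w} {inj₁ j} e = e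

  PreAdj⊎-irrefl : ∀ {x} → ¬ PreAdj⊎ x x
  PreAdj⊎-irrefl {inj₁ i} e = irrefl G e
  PreAdj⊎-irrefl {inj₂ w} ()

  KeptAdj : (Fin (size G + a) → Fin (size G + a) → Set) →
            Fin (size G + a) → Fin (size G + a) → Set
  KeptAdj Del x y = PreAdj x y × ¬ Del x y

record Slot (d : ℕ) (G : Graph) : Set₁ where
  field
    a          : ℕ
    parent     : Fin a → Fin (size G)
    parent-inj : Injective _≡_ _≡_ parent
    Extra      : Fin a → Fin (size G) → Set
    extra-ok   : ∀ w v → Extra w v → WithinDist G (d ∸ 1) (parent w) v
    Del        : Fin (size G + a) → Fin (size G + a) → Set
    Del-sym    : ∀ {x y} → Del x y → Del y x
    stays-connected : ∀ x y → Star (KeptAdj G parent Extra Del) x y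

result : ∀ {d G} → Slot d G → Graph
result {G = G} s = record
  { size   = size G + Slot.a s
  ; Adj    = KeptAdj G (Slot.parent s) (Slot.Extra s) (Slot.Del s)
  ; sym    = λ {u} {v} → λ { (e , nd) →
               PreAdj⊎-sym G (Slot.parent s) (Slot.Extra s)
                 {splitAt (size G) u} {splitAt (size G) v} e
               , λ d' → nd (Slot.Del-sym s d') }
  ; irrefl = λ {u} → λ { (e , _) →
               PreAdj⊎-irrefl G (Slot.parent s) (Slot.Extra s)
                 {splitAt (size G) u} e }
  }

G₀ : Graph
G₀ = record { size = 1 ; Adj = λ _ _ → ⊥ ; sym = λ () ; irrefl = λ () }

data Reaches (d : ℕ) : ℕ → Graph → Set₁ where
  start : Reaches d 0 G₀
  slot  : ∀ {k G} → Reaches d k G → (s : Slot d G) → Reaches d (suc k) (result s)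

Grows : ℕ → ℕ → Graph → Set₁
Grows d k G = Σ Graph λ H → Reaches d k H × (H ≅ G)

MinSlots : ℕ → Graph → ℕ → Set₁
MinSlots d G s = Grows d s G × (∀ k → Grows d k G → s ≤ k)

path : ℕ → Graph
path n = record
  { size   = n
  ; Adj    = λ i j → toℕ j ≡ suc (toℕ i) ⊎ toℕ i ≡ suc (toℕ j)
  ; sym    = λ { (inj₁ e) → inj₂ e ; (inj₂ e) → inj₁ e }
  ; irrefl = λ { (inj₁ e) → n≢sn e ; (inj₂ e) → n≢sn e }
  }
  where
  n≢sn : ∀ {m} → m ≢ suc m
  n≢sn ()

star : ℕ → Graph
star n = record
  { size   = n
  ; Adj    = λ i j → (toℕ i ≡ 0 × toℕ j ≢ 0) ⊎ (toℕ j ≡ 0 × toℕ i ≢ 0)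
  ; sym    = λ { (inj₁ (p , q)) → inj₂ (p , q) ; (inj₂ (p , q)) → inj₁ (p , q) }
  ; irrefl = λ { (inj₁ (p , q)) → q p ; (inj₂ (p , q)) → q p }
  }

-- With activation distance 1 an extra edge of a new vertex can only go to its
-- parent, so a slot attaches pendant vertices to distinct old vertices.  By
-- induction every edge of a grown graph is a bridge, hence the deletion phase
-- can never remove an edge (the graph would fall apart): a slot just hangs
-- leaves on the current graph.  Embed the result in a path: the old graph
-- occupies an interval, and each new leaf sits next to it on one of its two
-- sides, at most one per side, so n ≤ 2k once n ≥ 2.  In a star, a new leaf or
-- its parent is the centre, so a slot adds at most one vertex and n ≤ k + 1.
-- Hanging a leaf on each end of a path, and on the centre of a star, attains
-- these bounds.

module Submission where

open import Defs hiding (sym)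
open import Data.Bool using (Bool; false)
import Data.Bool.Properties as Bool
open import Data.Empty using (⊥; ⊥-elim)
open import Data.Fin using (Fin; zero; suc; toℕ; splitAt; join; _↑ˡ_; _↑ʳ_; inject₁; lower₁; fromℕ)
import Data.Fin.Properties as Fin
open import Data.Nat using (ℕ; suc; _+_; _∸_; _≤_; _<_; ⌈_/2⌉; s≤s; z≤n; s≤s⁻¹)
open import Data.Nat.Properties
  using (_≟_; ≤-antisym; ≤-reflexive; ≤-trans; n≤1+n; n<1+n; ≤∧≢⇒<; ≰⇒>; <-asym; 1+n≰n; 1+n≢n;
         suc-injective; m≤n+m; +-comm; +-suc; +-mono-≤; ∸-monoˡ-≤; ⌈n/2⌉-mono; n≡⌈n+n/2⌉)
open import Data.Product using (_×_; _,_; ∃-syntax; proj₁)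
open import Data.Sum using (_⊎_; inj₁; inj₂; [_,_]′)
import Data.Sum as Sum
open import Data.Sum.Function.Propositional using (_⊎-↔_)
open import Function using (id)
open import Function.Bundles using (_↔_; _⇔_; Inverse; Injection; Equivalence; mk↔ₛ′; mk⇔)
open import Function.Construct.Composition using (_↔-∘_; _⇔-∘_)
open import Function.Construct.Identity using (↔-id; ⇔-id)
open import Function.Construct.Symmetry using (↔-sym; ⇔-sym)
open import Function.Definitions using (Injective)
open import Function.Properties.Inverse using (↔⇒↣)
open import Relation.Binary.Construct.Closure.ReflexiveTransitive using (Star; ε; _◅_; _◅◅_; gmap)
open import Relation.Binary.PropositionalEquality
open import Relation.Nullary using (¬_; yes; no)
open import Relation.Nullary.Decidable using (isYes)

SameEdge : ∀ {A : Set} → A → A → A → A → Set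
SameEdge u v x y = (x ≡ u × y ≡ v) ⊎ (x ≡ v × y ≡ u)

record Bridge {A : Set} (R : A → A → Set) (u v : A) : Set where
  field
    side      : A → Bool
    separates : side u ≢ side v
    unique    : ∀ {x y} → R x y → side x ≢ side y → SameEdge u v x y

AllBridges : Graph → Set
AllBridges G = ∀ {u v} → Adj G u v → Bridge (Adj G) u v

walk-crosses : ∀ {A : Set} {R : A → A → Set} (S : A → Bool) → ∀ {x y} → Star R x y → S x ≢ S y →
               ∃[ p ] ∃[ q ] R p q × S p ≢ S q
walk-crosses S ε ne = ⊥-elim (ne refl)
walk-crosses S {x} (_◅_ {j = z} r rest) ne with S x Bool.≟ S z
... | no d  = x , z , r , d
... | yes e = walk-crosses S rest (λ e′ → ne (trans e e′))

module _ {A : Set} {R : A → A → Set} where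

  Bridge-swap : ∀ {u v} → Bridge R u v → Bridge R v u
  Bridge-swap b = record
    { side = side ; separates = λ e → separates (sym e) ; unique = λ r s → swap (unique r s) }
    where
    open Bridge b
    swap : ∀ {u v x y : A} → SameEdge u v x y → SameEdge v u x y
    swap (inj₁ p) = inj₂ p
    swap (inj₂ p) = inj₁ p

  Bridge-mono : ∀ {R′ : A → A → Set} → (∀ {x y} → R′ x y → R x y) →
                ∀ {u v} → Bridge R u v → Bridge R′ u v
  Bridge-mono R′⊆R b = record { side = side ; separates = separates ; unique = λ r → unique (R′⊆R r) }
    where open Bridge b

  -- A walk joining the ends of a bridge has to use the bridge itself.
  Bridge-undeletable : ∀ {D : A → A → Set} → (∀ {x y} → D x y → D y x) → ∀ {u v} →
                       Bridge R u v → Star (λ x y → R x y × ¬ D x y) u v → ¬ D u v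
  Bridge-undeletable D-sym b walk d
    with p , q , (r , ¬d) , cut ← walk-crosses (Bridge.side b) walk (Bridge.separates b)
    with Bridge.unique b r cut
  ... | inj₁ (refl , refl) = ¬d d
  ... | inj₂ (refl , refl) = ¬d (D-sym d)

Bridge-preimage : ∀ {A B : Set} {R : B → B → Set} (g : A → B) → Injective _≡_ _≡_ g →
                  ∀ {u v} → Bridge R (g u) (g v) → Bridge (λ x y → R (g x) (g y)) u v
Bridge-preimage g g-inj b = record
  { side = λ x → side (g x) ; separates = separates ; unique = λ r s → pull (unique r s) }
  where
  open Bridge b
  pull : ∀ {u v x y} → SameEdge (g u) (g v) (g x) (g y) → SameEdge u v x y
  pull (inj₁ (p , q)) = inj₁ (g-inj p , g-inj q)
  pull (inj₂ (p , q)) = inj₂ (g-inj p , g-inj q)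

WithinDist-zero : ∀ {G u v} → WithinDist G 0 u v → u ≡ v
WithinDist-zero here = refl

module Slot₁ {G : Graph} (s : Slot 1 G) where
  open Slot s

  private
    m = size G
    P⊎ = PreAdj⊎ G parent Extra

  NewEdge⇒parent : ∀ {w v} → NewEdge G parent Extra w v → v ≡ parent w
  NewEdge⇒parent (inj₁ e) = e
  NewEdge⇒parent {w} {v} (inj₂ x) = sym (WithinDist-zero (extra-ok w v x))

  pendant-bridge : ∀ w → Bridge P⊎ (inj₁ (parent w)) (inj₂ w)
  pendant-bridge w = record { side = isW ; separates = separates ; unique = unique }
    where
    isW : Fin m ⊎ Fin a → Bool
    isW (inj₁ _)  = false
    isW (inj₂ w′) = isYes (w′ Fin.≟ w)
    separates : isW (inj₁ (parent w)) ≢ isW (inj₂ w)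
    separates with w Fin.≟ w
    ... | yes _  = λ ()
    ... | no w≢w = λ _ → w≢w refl
    unique : ∀ {x y} → P⊎ x y → isW x ≢ isW y → SameEdge (inj₁ (parent w)) (inj₂ w) x y
    unique {inj₁ _}  {inj₁ _}  _ cut = ⊥-elim (cut refl)
    unique {inj₁ _}  {inj₂ w′} e cut with w′ Fin.≟ w
    ... | yes refl = inj₁ (cong inj₁ (NewEdge⇒parent e) , refl)
    ... | no _     = ⊥-elim (cut refl)
    unique {inj₂ w′} {inj₁ _}  e cut with w′ Fin.≟ w
    ... | yes refl = inj₂ (refl , cong inj₁ (NewEdge⇒parent e))
    ... | no _     = ⊥-elim (cut refl)

  old-bridge : ∀ {i j} → Bridge (Adj G) i j → Bridge P⊎ (inj₁ i) (inj₁ j)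
  old-bridge b = record { side = side⊎ ; separates = separates ; unique = unique⊎ }
    where
    open Bridge b
    side⊎ : Fin m ⊎ Fin a → Bool
    side⊎ = [ side , (λ w → side (parent w)) ]′
    unique⊎ : ∀ {x y} → P⊎ x y → side⊎ x ≢ side⊎ y → SameEdge (inj₁ _) (inj₁ _) x y
    unique⊎ {inj₁ _} {inj₁ _} e cut with unique e cut
    ... | inj₁ (refl , refl) = inj₁ (refl , refl)
    ... | inj₂ (refl , refl) = inj₂ (refl , refl)
    unique⊎ {inj₁ _} {inj₂ _} e cut = ⊥-elim (cut (cong side (NewEdge⇒parent e)))
    unique⊎ {inj₂ _} {inj₁ _} e cut = ⊥-elim (cut (cong side (sym (NewEdge⇒parent e))))

  module _ (bridges : AllBridges G) where

    bridge⊎ : ∀ {x y} → P⊎ x y → Bridge P⊎ x y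
    bridge⊎ {inj₁ _} {inj₁ _} e = old-bridge (bridges e)
    bridge⊎ {inj₁ _} {inj₂ w} e rewrite NewEdge⇒parent e = pendant-bridge w
    bridge⊎ {inj₂ w} {inj₁ _} e rewrite NewEdge⇒parent e = Bridge-swap (pendant-bridge w)

    PreAdj-bridge : ∀ {x y} → PreAdj G parent Extra x y → Bridge (PreAdj G parent Extra) x y
    PreAdj-bridge e = Bridge-preimage (splitAt m) (Injection.injective (↔⇒↣ Fin.+↔⊎)) (bridge⊎ e)

    -- No edge can be deleted without disconnecting G_t, since every edge is a bridge.
    kept : ∀ {x y} → PreAdj G parent Extra x y → Adj (result s) x y
    kept e = e , Bridge-undeletable Del-sym (PreAdj-bridge e) (stays-connected _ _)

    result-bridges : AllBridges (result s)
    result-bridges (e , _) = Bridge-mono proj₁ (PreAdj-bridge e)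

reaches-bridges : ∀ {k G} → Reaches 1 k G → AllBridges G
reaches-bridges start ()
reaches-bridges (slot r s) = Slot₁.result-bridges s (reaches-bridges r)

reaches-connected : ∀ {d k G} → Reaches d k G → Connected G
reaches-connected start zero zero = ε
reaches-connected (slot r s)      = Slot.stays-connected s

record Embedding (G T : Graph) : Set where
  field
    map       : Fin (size G) → Fin (size T)
    injective : Injective _≡_ _≡_ map
    adj       : ∀ {u v} → Adj G u v → Adj T (map u) (map v)

≅⇒Embedding : ∀ {G T} → G ≅ T → Embedding G T
≅⇒Embedding φ = record
  { map       = Inverse.to bij
  ; injective = Injection.injective (↔⇒↣ bij)
  ; adj       = λ {u} {v} → Equivalence.to (preserve u v)
  }
  where open _≅_ φ

≅-size : ∀ {G T} → G ≅ T → size T ≤ size G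
≅-size φ = Fin.injective⇒≤ (Injection.injective (↔⇒↣ (↔-sym (_≅_.bij φ))))

record PendantEmbedding (G T : Graph) (a : ℕ) : Set where
  field
    base             : Embedding G T
    parent           : Fin a → Fin (size G)
    parent-injective : Injective _≡_ _≡_ parent
    leaf             : Fin a → Fin (size T)
    leaf-injective   : Injective _≡_ _≡_ leaf
    leaf-fresh       : ∀ i w → Embedding.map base i ≢ leaf w
    leaf-adj         : ∀ w → Adj T (leaf w) (Embedding.map base (parent w))

↑ˡ≢↑ʳ : ∀ {m a} (i : Fin m) (w : Fin a) → i ↑ˡ a ≢ m ↑ʳ w
↑ˡ≢↑ʳ {m} {a} i w e
  with trans (sym (Fin.splitAt-↑ˡ m i a)) (trans (cong (splitAt m) e) (Fin.splitAt-↑ʳ m a w))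
... | ()

slot-pendantEmbedding : ∀ {G T} → AllBridges G → (s : Slot 1 G) → Embedding (result s) T →
                        PendantEmbedding G T (Slot.a s)
slot-pendantEmbedding {G} {T} bridges s e = record
  { base             = record { map = old ; injective = λ eq → Fin.↑ˡ-injective a _ _ (injective eq)
                              ; adj = λ {i} {j} ij → adj (kept bridges (PreAdj-old ij)) }
  ; parent           = parent
  ; parent-injective = parent-inj
  ; leaf             = new
  ; leaf-injective   = λ eq → Fin.↑ʳ-injective m _ _ (injective eq)
  ; leaf-fresh       = λ i w eq → ↑ˡ≢↑ʳ i w (injective eq)
  ; leaf-adj         = λ w → adj (kept bridges (PreAdj-new w))
  }
  where
  open Slot s
  open Slot₁ s
  open Embedding e
  m = size G
  old : Fin m → Fin (size T)
  old i = map (i ↑ˡ a)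
  new : Fin a → Fin (size T)
  new w = map (m ↑ʳ w)
  PreAdj-old : ∀ {i j} → Adj G i j → PreAdj G parent Extra (i ↑ˡ a) (j ↑ˡ a)
  PreAdj-old {i} {j} ij rewrite Fin.splitAt-↑ˡ m i a | Fin.splitAt-↑ˡ m j a = ij
  PreAdj-new : ∀ w → PreAdj G parent Extra (m ↑ʳ w) (parent w ↑ˡ a)
  PreAdj-new w rewrite Fin.splitAt-↑ʳ m a w | Fin.splitAt-↑ˡ m (parent w) a = inj₁ refl

walk-hits : ∀ {A : Set} {R : A → A → Set} (g : A → ℕ) →
            (∀ {x y} → R x y → g y ≡ suc (g x) ⊎ g x ≡ suc (g y)) →
            ∀ {x y z} → Star R x y → g x ≤ z → z ≤ g y → ∃[ t ] g t ≡ z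
walk-hits g unit {x} ε lo hi = x , ≤-antisym lo hi
walk-hits g unit {x} {z = z} (r ◅ rest) lo hi with g x ≟ z
... | yes gx≡z = x , gx≡z
... | no gx≢z with unit r
...   | inj₁ up   = walk-hits g unit rest (subst (_≤ z) (sym up) (≤∧≢⇒< lo gx≢z)) hi
...   | inj₂ down = walk-hits g unit rest (≤-trans (n≤1+n _) (subst (_≤ z) down lo)) hi

module PathPendants {G N a} (connected : Connected G) (P : PendantEmbedding G (path N) a) where
  open PendantEmbedding P
  open Embedding base

  pos : Fin (size G) → ℕ
  pos i = toℕ (map i)

  leafPos : Fin a → ℕ
  leafPos w = toℕ (leaf w)

  -- The image of the connected graph G is an interval that avoids every leaf.
  not-between : ∀ {i j w} → pos i ≤ leafPos w → leafPos w ≤ pos j → ⊥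
  not-between {i} {j} {w} lo hi with walk-hits pos adj (connected i j) lo hi
  ... | t , eq = leaf-fresh t w (Fin.toℕ-injective eq)

  left-leaf-below : ∀ {w} → pos (parent w) ≡ suc (leafPos w) → ∀ i → leafPos w < pos i
  left-leaf-below eq i = ≰⇒> λ i≤w → not-between i≤w (≤-trans (n≤1+n _) (≤-reflexive (sym eq)))

  right-leaf-above : ∀ {w} → leafPos w ≡ suc (pos (parent w)) → ∀ i → pos i < leafPos w
  right-leaf-above eq i = ≰⇒> λ w≤i → not-between (≤-trans (n≤1+n _) (≤-reflexive (sym eq))) w≤i

  direction : ∀ {x y} → Adj (path N) x y → Fin 2
  direction (inj₁ _) = zero
  direction (inj₂ _) = suc zero

  side : Fin a → Fin 2
  side w = direction (leaf-adj w)

  side-injective : Injective _≡_ _≡_ side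
  side-injective {w₁} {w₂} eq with leaf-adj w₁ | leaf-adj w₂
  ... | inj₁ e₁ | inj₁ e₂ = leaf-injective (Fin.toℕ-injective (≤-antisym
          (s≤s⁻¹ (subst (leafPos w₁ <_) e₂ (left-leaf-below e₁ (parent w₂))))
          (s≤s⁻¹ (subst (leafPos w₂ <_) e₁ (left-leaf-below e₂ (parent w₁))))))
  ... | inj₂ e₁ | inj₂ e₂ = leaf-injective (Fin.toℕ-injective (≤-antisym
          (subst (_≤ leafPos w₂) (sym e₁) (right-leaf-above e₂ (parent w₁)))
          (subst (_≤ leafPos w₁) (sym e₂) (right-leaf-above e₁ (parent w₂)))))

  pendants≤2 : a ≤ 2
  pendants≤2 = Fin.injective⇒≤ side-injective

module StarPendants {G N a} (P : PendantEmbedding G (star N) a) where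
  open PendantEmbedding P
  open Embedding base

  -- Each leaf or its parent is the centre; two leaves cannot use both options.
  pendants-equal : ∀ w₁ w₂ → w₁ ≡ w₂
  pendants-equal w₁ w₂ with leaf-adj w₁ | leaf-adj w₂
  ... | inj₁ (c₁ , _) | inj₁ (c₂ , _) = leaf-injective (Fin.toℕ-injective (trans c₁ (sym c₂)))
  ... | inj₁ (c₁ , _) | inj₂ (c₂ , _) =
    ⊥-elim (leaf-fresh (parent w₂) w₁ (Fin.toℕ-injective (trans c₂ (sym c₁))))
  ... | inj₂ (c₁ , _) | inj₁ (c₂ , _) =
    ⊥-elim (leaf-fresh (parent w₁) w₂ (Fin.toℕ-injective (trans c₁ (sym c₂))))
  ... | inj₂ (c₁ , _) | inj₂ (c₂ , _) =
    parent-injective (injective (Fin.toℕ-injective (trans c₁ (sym c₂))))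

  pendants≤1 : a ≤ 1
  pendants≤1 = Fin.injective⇒≤ {f = λ (_ : Fin a) → zero {0}} λ {w₁} {w₂} _ → pendants-equal w₁ w₂

-- The alternative size H ≡ 1 is needed for k = 0.
path-size-bound : ∀ {k H N} → Reaches 1 k H → Embedding H (path N) → size H ≡ 1 ⊎ size H ≤ k + k
path-size-bound start _ = inj₁ refl
path-size-bound {suc k} (slot {G = G} r s) e = grow (path-size-bound r base)
  where
  P = slot-pendantEmbedding (reaches-bridges r) s e
  open PendantEmbedding P
  a = Slot.a s
  grow : size G ≡ 1 ⊎ size G ≤ k + k → size G + a ≡ 1 ⊎ size G + a ≤ suc k + suc k
  grow (inj₁ refl) =
    inj₂ (s≤s (≤-trans (Fin.injective⇒≤ parent-injective) (≤-trans (s≤s z≤n) (m≤n+m (suc k) k))))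
  grow (inj₂ le)   = inj₂ (≤-trans (+-mono-≤ le (PathPendants.pendants≤2 (reaches-connected r) P))
                                   (≤-reflexive (trans (+-comm (k + k) 2) (cong suc (sym (+-suc k k))))))

star-size-bound : ∀ {k H N} → Reaches 1 k H → Embedding H (star N) → size H ≤ suc k
star-size-bound start _ = s≤s z≤n
star-size-bound {suc k} (slot r s) e =
  ≤-trans (+-mono-≤ (star-size-bound r (PendantEmbedding.base P)) (StarPendants.pendants≤1 P))
          (≤-reflexive (+-comm (suc k) 1))
  where P = slot-pendantEmbedding (reaches-bridges r) s e

path-lower-bound : ∀ {n k} → 2 ≤ n → Grows 1 k (path n) → ⌈ n /2⌉ ≤ k
path-lower-bound {n} 2≤n (H , r , φ) with path-size-bound r (≅⇒Embedding φ)
... | inj₁ size≡1 = ⊥-elim (1+n≰n (≤-trans 2≤n (subst (n ≤_) size≡1 (≅-size φ))))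
... | inj₂ le     = ≤-trans (⌈n/2⌉-mono (≤-trans (≅-size φ) le)) (≤-reflexive (sym (n≡⌈n+n/2⌉ _)))

star-lower-bound : ∀ {n k} → Grows 1 k (star n) → n ∸ 1 ≤ k
star-lower-bound (H , r , φ) = ∸-monoˡ-≤ 1 (≤-trans (≅-size φ) (star-size-bound r (≅⇒Embedding φ)))

NoExtra : ∀ {a m} → Fin a → Fin m → Set
NoExtra _ _ = ⊥

addLeaves : (G : Graph) {a : ℕ} → (Fin a → Fin (size G)) → Graph
addLeaves G {a} q = record
  { size   = size G + a
  ; Adj    = PreAdj G q NoExtra
  ; sym    = λ {x} {y} → PreAdj⊎-sym G q NoExtra {splitAt (size G) x} {splitAt (size G) y}
  ; irrefl = λ {x} → PreAdj⊎-irrefl G q NoExtra {splitAt (size G) x}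
  }

module _ (G : Graph) {a : ℕ} (q : Fin a → Fin (size G)) where
  private m = size G

  addLeaves-join : ∀ p r → Adj (addLeaves G q) (join m a p) (join m a r) ≡ PreAdj⊎ G q NoExtra p r
  addLeaves-join p r = cong₂ (PreAdj⊎ G q NoExtra) (Fin.splitAt-join m a p) (Fin.splitAt-join m a r)

  private
    lift : ∀ {i j} → Star (Adj G) i j → Star (Adj (addLeaves G q)) (i ↑ˡ a) (j ↑ˡ a)
    lift = gmap (_↑ˡ a) λ {i} {j} e → subst id (sym (addLeaves-join (inj₁ i) (inj₁ j))) e

    Anchored : Fin (m + a) → Set
    Anchored x = ∃[ i ] Star (Adj (addLeaves G q)) x (i ↑ˡ a) × Star (Adj (addLeaves G q)) (i ↑ˡ a) x

    anchor⊎ : ∀ p → Anchored (join m a p)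
    anchor⊎ (inj₁ i) = i , ε , ε
    anchor⊎ (inj₂ w) = q w , leaf-edge ◅ ε , Graph.sym (addLeaves G q) leaf-edge ◅ ε
      where
      leaf-edge : Adj (addLeaves G q) (m ↑ʳ w) (q w ↑ˡ a)
      leaf-edge = subst id (sym (addLeaves-join (inj₂ w) (inj₁ (q w)))) (inj₁ refl)

    anchor : ∀ x → Anchored x
    anchor x = subst Anchored (Fin.join-splitAt m a x) (anchor⊎ (splitAt m x))

  addLeaves-connected : Connected G → Connected (addLeaves G q)
  addLeaves-connected connected x y with anchor x | anchor y
  ... | i , x→i , _ | j , _ , j→y = x→i ◅◅ lift (connected i j) ◅◅ j→y

leafSlot : ∀ {d G a} → Connected G → (q : Fin a → Fin (size G)) → Injective _≡_ _≡_ q → Slot d G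
leafSlot {G = G} connected q q-inj = record
  { a = _ ; parent = q ; parent-inj = q-inj ; Extra = NoExtra ; extra-ok = λ _ _ ()
  ; Del = λ _ _ → ⊥ ; Del-sym = λ ()
  ; stays-connected = λ x y → gmap id (λ e → e , λ ()) (addLeaves-connected G q connected x y) }

result-leafSlot : ∀ {d G a} (connected : Connected G) (q : Fin a → Fin (size G))
                  (q-inj : Injective _≡_ _≡_ q) →
                  result (leafSlot {d} connected q q-inj) ≅ addLeaves G q
result-leafSlot _ _ _ = record { bij = ↔-id _ ; preserve = λ _ _ → mk⇔ proj₁ (λ e → e , λ ()) }

≅-trans : ∀ {G H K} → G ≅ H → H ≅ K → G ≅ K
≅-trans φ ψ = record
  { bij      = _≅_.bij ψ ↔-∘ _≅_.bij φ
  ; preserve = λ u v → _≅_.preserve ψ _ _ ⇔-∘ _≅_.preserve φ u v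
  }

Grows-≅ : ∀ {d k G G′} → Grows d k G → G ≅ G′ → Grows d k G′
Grows-≅ (H , r , φ) ψ = H , r , ≅-trans φ ψ

module _ {G T : Graph} {a : ℕ} (q : Fin a → Fin (size G)) (b : (Fin (size G) ⊎ Fin a) ↔ Fin (size T)) where
  open Inverse b using (to)

  addLeaves-≅ : (∀ i j → Adj G i j ⇔ Adj T (to (inj₁ i)) (to (inj₁ j))) →
                (∀ i w → i ≡ q w ⇔ Adj T (to (inj₁ i)) (to (inj₂ w))) →
                (∀ w w′ → ¬ Adj T (to (inj₂ w)) (to (inj₂ w′))) →
                addLeaves G q ≅ T
  addLeaves-≅ old-old old-new new-new = record
    { bij = b ↔-∘ Fin.+↔⊎ ; preserve = λ x y → adj⊎ (splitAt (size G) x) (splitAt (size G) y) }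
    where
    no-extra : ∀ {i w} → NewEdge G q NoExtra w i ⇔ (i ≡ q w)
    no-extra = mk⇔ [ id , (λ ()) ]′ inj₁
    T-sym : ∀ {x y} → Adj T x y ⇔ Adj T y x
    T-sym = mk⇔ (Graph.sym T) (Graph.sym T)
    adj⊎ : ∀ p r → PreAdj⊎ G q NoExtra p r ⇔ Adj T (to p) (to r)
    adj⊎ (inj₁ i) (inj₁ j)  = old-old i j
    adj⊎ (inj₁ i) (inj₂ w)  = old-new i w ⇔-∘ no-extra
    adj⊎ (inj₂ w) (inj₁ j)  = T-sym ⇔-∘ (old-new j w ⇔-∘ no-extra)
    adj⊎ (inj₂ w) (inj₂ w′) = mk⇔ (λ ()) (λ e → ⊥-elim (new-new w w′ e))

addLeaves-cong : ∀ {H G a} (φ : H ≅ G) (q : Fin a → Fin (size G)) →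
                 addLeaves H (λ w → Inverse.from (_≅_.bij φ) (q w)) ≅ addLeaves G q
addLeaves-cong {H} {G} {a} φ q =
  addLeaves-≅ (λ w → from (q w)) (↔-sym Fin.+↔⊎ ↔-∘ (bij ⊎-↔ ↔-id _)) old-old old-new new-new
  where
  open _≅_ φ
  open Inverse bij using (to; from; inverseˡ; inverseʳ)
  old-old : ∀ i j → Adj H i j ⇔ Adj (addLeaves G q) (to i ↑ˡ a) (to j ↑ˡ a)
  old-old i j = subst (Adj H i j ⇔_) (sym (addLeaves-join G q (inj₁ (to i)) (inj₁ (to j)))) (preserve i j)
  old-new : ∀ i w → i ≡ from (q w) ⇔ Adj (addLeaves G q) (to i ↑ˡ a) (size G ↑ʳ w)
  old-new i w = subst (i ≡ from (q w) ⇔_) (sym (addLeaves-join G q (inj₁ (to i)) (inj₂ w)))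
                      (mk⇔ (λ e → inj₁ (inverseˡ e)) λ { (inj₁ e) → sym (inverseʳ (sym e)) ; (inj₂ ()) })
  new-new : ∀ w w′ → ¬ Adj (addLeaves G q) (size G ↑ʳ w) (size G ↑ʳ w′)
  new-new w w′ e = subst id (addLeaves-join G q (inj₂ w) (inj₂ w′)) e

Grows-addLeaves : ∀ {d k G a} → Grows d k G → (q : Fin a → Fin (size G)) → Injective _≡_ _≡_ q →
                  Grows d (suc k) (addLeaves G q)
Grows-addLeaves {d} (H , r , φ) q q-inj =
  result s , slot r s , ≅-trans (result-leafSlot {d} (reaches-connected r) q′ q′-inj) (addLeaves-cong φ q)
  where
  q′ = λ w → Inverse.from (_≅_.bij φ) (q w)
  q′-inj : Injective _≡_ _≡_ q′
  q′-inj e = q-inj (Injection.injective (↔⇒↣ (↔-sym (_≅_.bij φ))) e)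
  s = leafSlot (reaches-connected r) q′ q′-inj

module _ {G T : Graph} {a : ℕ} (q : Fin a → Fin (size G)) (R : ℕ → ℕ → Set)
         (T-adj : ∀ i j → Adj T i j ⇔ R (toℕ i) (toℕ j))
         (b : (Fin (size G) ⊎ Fin a) ↔ Fin (size T)) (label : Fin (size G) ⊎ Fin a → ℕ)
         (toℕ-label : ∀ p → toℕ (Inverse.to b p) ≡ label p) where

  private
    relabel : ∀ p r → R (label p) (label r) ⇔ Adj T (Inverse.to b p) (Inverse.to b r)
    relabel p r = subst₂ (λ x y → R x y ⇔ Adj T (Inverse.to b p) (Inverse.to b r))
                         (toℕ-label p) (toℕ-label r) (⇔-sym (T-adj _ _))

  addLeaves-≅ℕ : (∀ i j → Adj G i j ⇔ R (label (inj₁ i)) (label (inj₁ j))) →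
                 (∀ i w → i ≡ q w ⇔ R (label (inj₁ i)) (label (inj₂ w))) →
                 (∀ w w′ → ¬ R (label (inj₂ w)) (label (inj₂ w′))) →
                 addLeaves G q ≅ T
  addLeaves-≅ℕ old-old old-new new-new = addLeaves-≅ q b
    (λ i j → relabel _ _ ⇔-∘ old-old i j)
    (λ i w → relabel _ _ ⇔-∘ old-new i w)
    (λ w w′ e → new-new w w′ (Equivalence.from (relabel _ _) e))

snoc : ∀ {m} → (Fin m ⊎ Fin 1) ↔ Fin (suc m)
snoc {m} = mk↔ₛ′ to from to-from from-to
  where
  to : Fin m ⊎ Fin 1 → Fin (suc m)
  to (inj₁ i) = inject₁ i
  to (inj₂ _) = fromℕ m
  from : Fin (suc m) → Fin m ⊎ Fin 1
  from j with m ≟ toℕ j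
  ... | yes _   = inj₂ zero
  ... | no m≢j  = inj₁ (lower₁ j m≢j)
  to-from : ∀ j → to (from j) ≡ j
  to-from j with m ≟ toℕ j
  ... | yes m≡j = Fin.toℕ-injective (trans (Fin.toℕ-fromℕ m) m≡j)
  ... | no m≢j  = Fin.inject₁-lower₁ j m≢j
  from-to : ∀ p → from (to p) ≡ p
  from-to (inj₁ i) with m ≟ toℕ (inject₁ i)
  ... | yes m≡i = ⊥-elim (Fin.toℕ-inject₁-≢ i m≡i)
  ... | no m≢i  = cong inj₁ (Fin.lower₁-inject₁′ i m≢i)
  from-to (inj₂ zero) with m ≟ toℕ (fromℕ m)
  ... | yes _   = refl
  ... | no m≢m  = ⊥-elim (m≢m (sym (Fin.toℕ-fromℕ m)))

ends : ∀ {m} → (Fin m ⊎ Fin 2) ↔ Fin (suc (suc m))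
ends {m} = mk↔ₛ′ to from to-from from-to
  where
  open Inverse (snoc {m}) using () renaming (to to snoc-to; from to snoc-from)
  to : Fin m ⊎ Fin 2 → Fin (suc (suc m))
  to (inj₁ i)          = suc (snoc-to (inj₁ i))
  to (inj₂ zero)       = zero
  to (inj₂ (suc zero)) = suc (snoc-to (inj₂ zero))
  last : Fin m ⊎ Fin 1 → Fin m ⊎ Fin 2
  last = Sum.map₂ (λ _ → suc zero)
  from : Fin (suc (suc m)) → Fin m ⊎ Fin 2
  from zero    = inj₂ zero
  from (suc j) = last (snoc-from j)
  to-last : ∀ p → to (last p) ≡ suc (snoc-to p)
  to-last (inj₁ _)    = refl
  to-last (inj₂ zero) = refl
  to-from : ∀ j → to (from j) ≡ j
  to-from zero    = refl
  to-from (suc j) = trans (to-last (snoc-from j)) (cong suc (Inverse.strictlyInverseˡ snoc j))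
  from-to : ∀ p → from (to p) ≡ p
  from-to (inj₁ i)          = cong last (Inverse.strictlyInverseʳ snoc (inj₁ i))
  from-to (inj₂ zero)       = refl
  from-to (inj₂ (suc zero)) = cong last (Inverse.strictlyInverseʳ snoc (inj₂ zero))

snocLabel : ∀ {m} → Fin m ⊎ Fin 1 → ℕ
snocLabel     (inj₁ i) = toℕ i
snocLabel {m} (inj₂ _) = m

toℕ-snoc : ∀ {m} p → toℕ (Inverse.to (snoc {m}) p) ≡ snocLabel p
toℕ-snoc     (inj₁ i)    = Fin.toℕ-inject₁ i
toℕ-snoc {m} (inj₂ zero) = Fin.toℕ-fromℕ m

endsLabel : ∀ {m} → Fin m ⊎ Fin 2 → ℕ
endsLabel     (inj₁ i)          = suc (toℕ i)
endsLabel     (inj₂ zero)       = 0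
endsLabel {m} (inj₂ (suc zero)) = suc m

toℕ-ends : ∀ {m} p → toℕ (Inverse.to (ends {m}) p) ≡ endsLabel p
toℕ-ends (inj₁ i)          = cong suc (toℕ-snoc (inj₁ i))
toℕ-ends (inj₂ zero)       = refl
toℕ-ends (inj₂ (suc zero)) = cong suc (toℕ-snoc (inj₂ zero))

-- Adj (path N) i j and Adj (star N) i j unfold to these relations on toℕ i and toℕ j.
PathAdjℕ : ℕ → ℕ → Set
PathAdjℕ x y = y ≡ suc x ⊎ x ≡ suc y

StarAdjℕ : ℕ → ℕ → Set
StarAdjℕ x y = (x ≡ 0 × y ≢ 0) ⊎ (y ≡ 0 × x ≢ 0)

PathAdjℕ-irrefl : ∀ {x} → ¬ PathAdjℕ x x
PathAdjℕ-irrefl (inj₁ e) = 1+n≢n (sym e)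
PathAdjℕ-irrefl (inj₂ e) = 1+n≢n (sym e)

PathAdjℕ-sym : ∀ {x y} → PathAdjℕ x y ⇔ PathAdjℕ y x
PathAdjℕ-sym = mk⇔ Sum.swap Sum.swap

PathAdjℕ-suc : ∀ {x y} → PathAdjℕ x y ⇔ PathAdjℕ (suc x) (suc y)
PathAdjℕ-suc = mk⇔ (Sum.map (cong suc) (cong suc)) (Sum.map suc-injective suc-injective)

first-adj : ∀ {n} (i : Fin (suc n)) → i ≡ zero ⇔ PathAdjℕ 0 (suc (toℕ i))
first-adj i = mk⇔ (λ { refl → inj₁ refl })
                  (λ { (inj₁ e) → Fin.toℕ-injective (suc-injective e) ; (inj₂ ()) })

last-adj : ∀ {n} (i : Fin (suc n)) → i ≡ fromℕ n ⇔ PathAdjℕ (toℕ i) (suc n)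
last-adj {n} i = mk⇔
  (λ { refl → inj₁ (cong suc (sym (Fin.toℕ-fromℕ n))) })
  (λ { (inj₁ e) → Fin.toℕ-injective (trans (sym (suc-injective e)) (sym (Fin.toℕ-fromℕ n)))
     ; (inj₂ e) → ⊥-elim (<-asym (Fin.toℕ<n i) (subst (suc n <_) (sym e) (n<1+n (suc n)))) })

Fin1-injective : ∀ {B : Set} (f : Fin 1 → B) → Injective _≡_ _≡_ f
Fin1-injective f {zero} {zero} _ = refl

append-path : ∀ n → addLeaves (path (suc n)) (λ (_ : Fin 1) → fromℕ n) ≅ path (suc (suc n))
append-path n =
  addLeaves-≅ℕ _ PathAdjℕ (λ _ _ → ⇔-id _) snoc snocLabel toℕ-snoc (λ _ _ → ⇔-id _) old-new new-new
  where
  old-new : ∀ (i : Fin (suc n)) w → i ≡ fromℕ n ⇔ PathAdjℕ (toℕ i) (suc n)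
  old-new i zero = last-adj i
  new-new : ∀ (w w′ : Fin 1) → ¬ PathAdjℕ (suc n) (suc n)
  new-new zero zero = PathAdjℕ-irrefl

endpoints : ∀ n → Fin 2 → Fin (suc (suc n))
endpoints n zero       = zero
endpoints n (suc zero) = fromℕ (suc n)

endpoints-injective : ∀ n → Injective _≡_ _≡_ (endpoints n)
endpoints-injective n {zero}     {zero}     _ = refl
endpoints-injective n {suc zero} {suc zero} _ = refl
endpoints-injective n {zero}     {suc zero} ()
endpoints-injective n {suc zero} {zero}     ()

extend-path : ∀ n → addLeaves (path (suc (suc n))) (endpoints n) ≅ path (suc (suc (suc (suc n))))
extend-path n =
  addLeaves-≅ℕ _ PathAdjℕ (λ _ _ → ⇔-id _) ends endsLabel toℕ-ends (λ _ _ → PathAdjℕ-suc) old-new new-new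
  where
  old-new : ∀ i w → i ≡ endpoints n w ⇔ PathAdjℕ (suc (toℕ i)) (endsLabel (inj₂ w))
  old-new i zero       = PathAdjℕ-sym ⇔-∘ first-adj i
  old-new i (suc zero) = PathAdjℕ-suc ⇔-∘ last-adj i
  new-new : ∀ w w′ → ¬ PathAdjℕ (endsLabel {suc (suc n)} (inj₂ w)) (endsLabel {suc (suc n)} (inj₂ w′))
  new-new zero       zero       = PathAdjℕ-irrefl
  new-new zero       (suc zero) = λ { (inj₁ ()) ; (inj₂ ()) }
  new-new (suc zero) zero       = λ { (inj₁ ()) ; (inj₂ ()) }
  new-new (suc zero) (suc zero) = PathAdjℕ-irrefl

append-star : ∀ n → addLeaves (star (suc n)) (λ (_ : Fin 1) → zero) ≅ star (suc (suc n))
append-star n =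
  addLeaves-≅ℕ _ StarAdjℕ (λ _ _ → ⇔-id _) snoc snocLabel toℕ-snoc (λ _ _ → ⇔-id _) old-new new-new
  where
  old-new : ∀ (i : Fin (suc n)) w → i ≡ zero ⇔ StarAdjℕ (toℕ i) (suc n)
  old-new i zero = mk⇔ (λ { refl → inj₁ (refl , λ ()) })
                       (λ { (inj₁ (e , _)) → Fin.toℕ-injective e ; (inj₂ (() , _)) })
  new-new : ∀ (w w′ : Fin 1) → ¬ StarAdjℕ (suc n) (suc n)
  new-new zero zero (inj₁ (() , _))
  new-new zero zero (inj₂ (() , _))

G₀≅path1 : G₀ ≅ path 1
G₀≅path1 = record { bij = ↔-id _ ; preserve = λ { zero zero → mk⇔ (λ ()) PathAdjℕ-irrefl } }

G₀≅star1 : G₀ ≅ star 1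
G₀≅star1 = record { bij = ↔-id _ ; preserve = λ { zero zero → mk⇔ (λ ()) (Graph.irrefl (star 1)) } }

path-grows : ∀ {d} n → Grows d ⌈ suc (suc n) /2⌉ (path (suc (suc n)))
path-grows 0 = Grows-≅ (Grows-addLeaves (G₀ , start , G₀≅path1) _ (Fin1-injective _)) (append-path 0)
path-grows 1 = Grows-≅ (Grows-addLeaves (path-grows 0) _ (Fin1-injective _)) (append-path 1)
path-grows (suc (suc n)) =
  Grows-≅ (Grows-addLeaves (path-grows n) (endpoints n) (endpoints-injective n)) (extend-path n)

star-grows : ∀ {d} n → Grows d n (star (suc n))
star-grows 0       = G₀ , start , G₀≅star1
star-grows (suc n) = Grows-≅ (Grows-addLeaves (star-grows n) _ (Fin1-injective _)) (append-star n)

mainTheorem20 : ((n : ℕ) → 2 ≤ n → MinSlots 1 (path n) ⌈ n /2⌉)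
                × ((n : ℕ) → 1 ≤ n → MinSlots 1 (star n) (n ∸ 1))
mainTheorem20 = path-minSlots , star-minSlots
  where
  path-minSlots : (n : ℕ) → 2 ≤ n → MinSlots 1 (path n) ⌈ n /2⌉
  path-minSlots (suc (suc n)) 2≤n = path-grows n , λ _ → path-lower-bound 2≤n
  path-minSlots 1 (s≤s ())
  star-minSlots : (n : ℕ) → 1 ≤ n → MinSlots 1 (star n) (n ∸ 1)
  star-minSlots (suc n) _ = star-grows n , λ _ → star-lower-bound
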